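{- Let $(X,A,\prec)$ be an alignment of finite posets $(X_a,\prec_a)$, $a\in I$, let $\mathfrak{P}$ be a non-trivial partition of $I$ with classes $I_1,\dots,I_p$, and $X_i=\bigcup_{a\in I_i}X_a$. For each $i$ let $C_i$ be the set of non-empty sets $Q\cap X_i$, $Q\in\mathcal{C}(X,A)$, partially ordered by $P\cap X_i\prec_i Q\cap X_i$ iff $P\prec Q$. Let $(X,A)/\mathfrak{P}$ be the graph with vertex set the disjoint union of the $C_i$ and with edges $\{Q\cap X_i,Q\cap X_j\}$ ($i\ne j$) whenever both sets are non-empty; its connected components are the sets $Q'=\{Q\cap X_i: Q\cap X_i\neq\emptyset\}$, in bijection with $\mathcal{C}(X,A)$, and we order them by $P'\prec Q'$ iff $P\prec Q$. Then $(X,A,\prec)/\mathfrak{P}$, i.e. $(X,A)/\mathfrak{P}$ with this order on its components, is an alignment of the posets $(C_i,\prec_i)$, $i=1,\dots,p$.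
   Context: Let $(X_a,\prec_a)$ be a finite collection of finite partially ordered sets (rows), $X$ their disjoint union, an element $i\in X_a$ being written $(a,i)$. For a graph $(X,A)$, $\mathcal{C}(X,A)$ denotes its set of connected components (columns). An alignment of the $(X_a,\prec_a)$ is a triple $(X,A,\prec)$ where $(X,A)$ is a graph on $X$ and $\prec$ is a strict partial order on $\mathcal{C}(X,A)$ such that: (A1) every $Q\in\mathcal{C}(X,A)$ is a complete subgraph of $(X,A)$; (A2) if $(a,i)\in Q$ and $(a,j)\in Q$ then $i=j$; (A3) if $(a,i)\in P$, $(a,j)\in Q$ and $(a,i)\prec_a(a,j)$ then $P\prec Q$; (A4) if $P\prec Q$, $(a,i)\in P$ and $(a,j)\in Q$, then $(a,i)\prec_a(a,j)$ or $(a,i)$ and $(a,j)$ are incomparable w.r.t. $\prec_a$. The same definition applies with the rows $(C_i,\prec_i)$ in place of the $(X_a,\prec_a)$. -}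

module Defs where

open import Level using (0ℓ)
open import Data.Nat using (ℕ; _≤_)
open import Data.Fin using (Fin)
open import Data.Product using (Σ; ∃; _×_; _,_; proj₁; proj₂)
open import Data.Sum using (_⊎_)
open import Relation.Nullary using (¬_)
open import Relation.Binary.Core using (Rel)
open import Relation.Binary.Structures using (IsStrictPartialOrder)
open import Relation.Binary.PropositionalEquality using (_≡_; _≢_)
open import Relation.Binary.Construct.Closure.Equivalence using (EqClosure)

-- Since the rows C_i of the quotient alignment are
-- sets of sets (equivalence classes), and Agda has no quotients, a row
-- is given as a setoid: a carrier with an equality `eq a`, together with
-- the strict order `lt a`.  For ordinary sets (as in the hypothesis)
-- `eq a` is propositional equality.

record Rows : Set₁ where
  field
    Idx  : Set
    Elem : Idx → Set
    eq   : (a : Idx) → Rel (Elem a) 0ℓ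
    lt   : (a : Idx) → Rel (Elem a) 0ℓ

module _ (R : Rows) where
  open Rows R

  AreStrictPosets : Set
  AreStrictPosets = (a : Idx) → IsStrictPartialOrder (eq a) (lt a)

  X : Set
  X = Σ Idx Elem

  data _≈X_ : X → X → Set where
    same : ∀ {a i j} → eq a i j → (a , i) ≈X (a , j)

  record IsGraph (A : Rel X 0ℓ) : Set where
    field
      resp   : ∀ {x x' y y'} → x ≈X x' → y ≈X y' → A x y → A x' y'
      sym    : ∀ {x y} → A x y → A y x
      irrefl : ∀ {x y} → A x y → ¬ (x ≈X y)

  Conn : Rel X 0ℓ → Rel X 0ℓ
  Conn A = EqClosure (λ x y → A x y ⊎ x ≈X y)

  -- The connected components are the classes
  -- of the equivalence relation `Conn A`; a strict partial order on the
  -- set of components C(X,A) is represented (without quotients) as a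
  -- relation `prec` on X which is a strict partial order w.r.t. `Conn A`
  -- (irreflexive modulo Conn A, transitive, respecting Conn A), i.e.
  -- `prec x y` means  comp(x) ≺ comp(y).
  record IsAlignment (A : Rel X 0ℓ) (prec : Rel X 0ℓ) : Set where
    field
      graph : IsGraph A
      order : IsStrictPartialOrder (Conn A) prec
      A1 : ∀ {x y} → Conn A x y → ¬ (x ≈X y) → A x y
      A2 : ∀ {a i j} → Conn A (a , i) (a , j) → eq a i j
      A3 : ∀ {a i j} → lt a i j → prec (a , i) (a , j)
      A4 : ∀ {a i j} → prec (a , i) (a , j) →
           lt a i j ⊎ (¬ lt a i j × ¬ lt a j i)

FinRows : (m : ℕ) (n : Fin m → ℕ) (ltr : (a : Fin m) → Rel (Fin (n a)) 0ℓ) → Rows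
FinRows m n ltr = record
  { Idx = Fin m ; Elem = λ a → Fin (n a) ; eq = λ _ → _≡_ ; lt = ltr }

IsNontrivialPartition : (m p : ℕ) → (Fin m → Fin p) → Set
IsNontrivialPartition m p blk = (2 ≤ p) × ((k : Fin p) → ∃ λ a → blk a ≡ k)

module Quotient (R : Rows) (A prec : Rel (X R) 0ℓ)
                (p : ℕ) (blk : Rows.Idx R → Fin p) where
  open Rows R

  Xk : Fin p → Set
  Xk k = Σ (X R) (λ x → blk (proj₁ x) ≡ k)

  -- The row C_k: the non-empty sets Q ∩ X_k.  Such a set is represented
  -- by any of its elements x ∈ X_k (Q being the component of x); two
  -- representatives denote the same set iff they lie in the same
  -- component.
  C : Rows
  C = record
    { Idx  = Fin p
    ; Elem = Xk
    ; eq   = λ _ x y → Conn R A (proj₁ x) (proj₁ y)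
    ; lt   = λ _ x y → prec (proj₁ x) (proj₁ y)
    }

  A/ : Rel (X C) 0ℓ
  A/ (i , x) (j , y) = (i ≢ j) × Conn R A (proj₁ x) (proj₁ y)

  prec/ : Rel (X C) 0ℓ
  prec/ (i , x) (j , y) = prec (proj₁ x) (proj₁ y)

module Submission where

open import Defs
open import Level using (0ℓ)
open import Data.Nat using (ℕ)
open import Data.Fin using (Fin)
open import Data.Product using (_×_; _,_; proj₁; proj₂)
open import Data.Sum using (_⊎_; inj₁; inj₂)
open import Relation.Nullary using (¬_)
open import Relation.Binary.Core using (Rel; _=[_]⇒_)
open import Relation.Binary.Structures using (IsStrictPartialOrder)
open import Relation.Binary.PropositionalEquality using (_≡_; refl; ≢-sym)
import Relation.Binary.Construct.On as On
import Relation.Binary.Construct.Closure.Equivalence as EqClosure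

-- A set Q ∩ X_k is represented by any of its elements, and rows, edges and
-- order of the quotient are all read off representatives through the
-- component relation of (X , A).  So every component of (X , A)/𝔓 lies in a
-- single component of (X , A), and each axiom of the quotient reduces to the
-- corresponding property of (X , A , ≺); (A3) and (A4) are immediate since
-- ≺_k is the restriction of ≺.

module QuotientAlignment (R : Rows) {A prec : Rel (X R) 0ℓ}
                         (p : ℕ) (blk : Rows.Idx R → Fin p)
                         (al : IsAlignment R A prec) where
  open Quotient R A prec p blk
  open IsAlignment al
  module ≺ = IsStrictPartialOrder order
  module ConnA = ≺.Eq

  representative : X C → X R
  representative (_ , x , _) = x

  Conn/⇒Conn : Conn C A/ =[ representative ]⇒ Conn R A
  Conn/⇒Conn = EqClosure.gfold ≺.isEquivalence representative step
    where
    step : ∀ {u v} → A/ u v ⊎ _≈X_ C u v → Conn R A (representative u) (representative v)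
    step (inj₁ (_ , c)) = c
    step (inj₂ (same c)) = c

  C-areStrictPosets : AreStrictPosets C
  C-areStrictPosets _ = On.isStrictPartialOrder proj₁ order

  A/-isGraph : IsGraph C A/
  A/-isGraph = record
    { resp   = λ { (same c₁) (same c₂) (i≢j , c) →
                   i≢j , ConnA.trans (ConnA.sym c₁) (ConnA.trans c c₂) }
    ; sym    = λ (i≢j , c) → ≢-sym i≢j , ConnA.sym c
    ; irrefl = λ { (i≢i , _) (same _) → i≢i refl }
    }

  prec/-isStrictPartialOrder : IsStrictPartialOrder (Conn C A/) prec/
  prec/-isStrictPartialOrder = record
    { isEquivalence = EqClosure.isEquivalence _
    ; irrefl        = λ c → ≺.irrefl (Conn/⇒Conn c)
    ; trans         = ≺.trans
    ; <-resp-≈      = (λ c → proj₁ ≺.<-resp-≈ (Conn/⇒Conn c))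
                    , (λ c → proj₂ ≺.<-resp-≈ (Conn/⇒Conn c))
    }

  Conn/-complete : ∀ {u v} → Conn C A/ u v → ¬ (_≈X_ C u v) → A/ u v
  Conn/-complete {i , _} {j , _} c u≉v = i≢j , Conn/⇒Conn c
    where
    i≢j : ¬ (i ≡ j)
    i≢j refl = u≉v (same (Conn/⇒Conn c))

  quotient-isAlignment : IsAlignment C A/ prec/
  quotient-isAlignment = record
    { graph = A/-isGraph
    ; order = prec/-isStrictPartialOrder
    ; A1    = Conn/-complete
    ; A2    = Conn/⇒Conn
    ; A3    = λ x≺y → x≺y
    ; A4    = inj₁
    }

lemma3p3 : (m : ℕ) (n : Fin m → ℕ) (ltr : (a : Fin m) → Rel (Fin (n a)) 0ℓ)
           (A prec : Rel (X (FinRows m n ltr)) 0ℓ)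
           (p : ℕ) (blk : Fin m → Fin p) →
           AreStrictPosets (FinRows m n ltr) →
           IsAlignment (FinRows m n ltr) A prec →
           IsNontrivialPartition m p blk →
           AreStrictPosets (Quotient.C (FinRows m n ltr) A prec p blk)
           × IsAlignment (Quotient.C (FinRows m n ltr) A prec p blk)
               (Quotient.A/ (FinRows m n ltr) A prec p blk)
               (Quotient.prec/ (FinRows m n ltr) A prec p blk)
lemma3p3 m n ltr A prec p blk _ al _ = C-areStrictPosets , quotient-isAlignment
  where open QuotientAlignment (FinRows m n ltr) p blk al
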